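{- Let $\iota$ be the Bernoulli umbra and let $s(n,1)=(-1)^{n-1}(n-1)!$, $n\ge1$, be the Stirling numbers of the first kind with $k=1$. Then $$s(n,1)\simeq(n.\iota)^{n-1},\qquad n=1,2,\ldots,$$ i.e. $E[(n.\iota)^{n-1}]=(-1)^{n-1}(n-1)!$.
   Context: Classical umbral calculus: umbrae are symbols with a linear evaluation $E$ ($E[1]=1$, multiplicative on products of powers of distinct umbrae), over a commutative integral domain $R$ whose quotient field has characteristic $0$. An umbra $\alpha$ has moments $E[\alpha^n]$ and g.f. $f(\alpha,t)=\sum_nE[\alpha^n]t^n/n!$; $p\simeq q$ means $E[p]=E[q]$. For an integer $n\ge0$, $n.\alpha$ is the umbra with g.f. $f(\alpha,t)^n$ (sum of $n$ uncorrelated copies of $\alpha$). The Bernoulli umbra $\iota$ is the umbra with g.f. $f(\iota,t)=t/(e^t-1)$ (moments the Bernoulli numbers); thus $n.\iota$ has g.f. $(t/(e^t-1))^n$. -}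

module Defs where

open import Data.Nat using (ℕ; zero; suc; _!)
open import Data.Nat.Combinatorics using (_C_)
open import Data.Integer using (+_)
open import Data.Rational using (ℚ; _/_; _+_; _*_; -_; 0ℚ; 1ℚ)
open import Data.List using (List; foldr; map; upTo)
open import Relation.Binary.PropositionalEquality using (_≡_)

ℕ→ℚ : ℕ → ℚ
ℕ→ℚ k = + k / 1

Σ≤ : ℕ → (ℕ → ℚ) → ℚ
Σ≤ m f = foldr _+_ 0ℚ (map f (upTo (suc m)))

-- A moment sequence a encodes the exponential generating function
--   f(t) = Σ_n a n · t^n / n!.
Moments : Set
Moments = ℕ → ℚ

-- Product of exponential generating functions (binomial convolution);
-- this is the moment sequence of the sum of two uncorrelated umbrae.
_⊛_ : Moments → Moments → Moments
(a ⊛ b) m = Σ≤ m (λ k → ℕ→ℚ (m C k) * (a k * b (m Data.Nat.∸ k)))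

-- The unit e.g.f. 1 (moments of the augmentation umbra ε).
δ : Moments
δ zero    = 1ℚ
δ (suc _) = 0ℚ

-- n.α : e.g.f. f(α,t)^n.
_·ᵘ_ : ℕ → Moments → Moments
zero  ·ᵘ a = δ
suc n ·ᵘ a = a ⊛ (n ·ᵘ a)

-- The e.g.f. (e^t - 1)/t = Σ_m t^m/(m+1)!, i.e. moments 1/(m+1).
expm1/t : Moments
expm1/t m = + 1 / suc m

-- a is the moment sequence of the Bernoulli umbra ι:
-- f(ι,t) · (e^t - 1)/t = 1, i.e. f(ι,t) = t/(e^t - 1).
IsBernoulliUmbra : Moments → Set
IsBernoulliUmbra a = ∀ m → (a ⊛ expm1/t) m ≡ δ m


sign : ℕ → ℚ
sign zero    = 1ℚ
sign (suc k) = - sign k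

-- Stirling number of the first kind s(n,1) = (-1)^(n-1) (n-1)!, n ≥ 1,
-- written for n = suc k.
s1 : ℕ → ℚ
s1 k = sign k * ℕ→ℚ (k !)

-- From β (e^t − 1) = t one gets the Riccati equation t β′ = β − t β − β²,
-- hence t (βⁿ)′ = n (βⁿ − t βⁿ − βⁿ⁺¹). For n = k + 1 the coefficients of t^{k+1} of
-- t (βⁿ)′ and n βⁿ cancel, leaving E[((k+2).ι)^{k+1}] = −(k+1) E[((k+1).ι)^k];
-- together with E[ι⁰] = 1 this gives (−1)^k k!.
module Submission where

open import Defs
open import Data.Nat as ℕ using (ℕ; zero; suc; _∸_; _<_; _!; s≤s; z≤n)
open import Data.Nat.Properties using (+-∸-assoc; ≤-pred; n<1+n)
open import Data.Nat.Combinatorics using (_C_; nCk+nC[k+1]≡[n+1]C[k+1]; k>n⇒nCk≡0)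
open import Data.Nat.Coprimality using (1-coprimeTo) renaming (sym to coprime-sym)
import Data.Integer as ℤ
import Data.Integer.Properties as ℤ
open import Data.Rational using (ℚ; mkℚ; _/_; _+_; _*_; -_; 0ℚ; 1ℚ; 1/_; NonZero)
open import Data.Rational.Properties
  using (normalize-coprime; normalize-pos; pos⇒nonZero; *-inverseˡ; *-inverseʳ; *-zeroˡ; +-identityʳ; *-identityˡ; *-identityʳ;
         +-comm; +-assoc; *-comm; *-assoc; *-zeroʳ; +-0-isCommutativeMonoid; +-0-group)
open import Data.Rational.Solver using (module +-*-Solver)
open import Algebra.Bundles using (CommutativeSemiring)
open import Algebra.Properties.Group +-0-group using (identityʳ-unique; inverseʳ-unique)
import Algebra.Construct.Pointwise as Pointwise
import Algebra.Solver.Ring.NaturalCoefficients.Default as CommutativeSemiringSolver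
open import Data.List using (_∷_; foldr; map; applyUpTo)
open import Relation.Binary.PropositionalEquality using (_≡_; refl; sym; trans; cong; cong₂; isEquivalence; module ≡-Reasoning)
open ≡-Reasoning

open +-*-Solver using (solve; _:=_; _:+_; _:*_; :-_; con)

ℕ→ℚ≡mkℚ : ∀ k → ℕ→ℚ k ≡ mkℚ (ℤ.+ k) 0 (coprime-sym (1-coprimeTo k))
ℕ→ℚ≡mkℚ k = normalize-coprime (coprime-sym (1-coprimeTo k))

ℕ→ℚ-+ : ∀ a b → ℕ→ℚ (a ℕ.+ b) ≡ ℕ→ℚ a + ℕ→ℚ b
ℕ→ℚ-+ a b = begin
  ℤ.+ (a ℕ.+ b) / 1                        ≡⟨ cong (_/ 1) (ℤ.pos-+ a b) ⟩
  (ℤ.+ a ℤ.+ ℤ.+ b) / 1                    ≡⟨ cong (_/ 1) (sym (cong₂ ℤ._+_ (ℤ.*-identityʳ (ℤ.+ a)) (ℤ.*-identityʳ (ℤ.+ b)))) ⟩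
  (ℤ.+ a ℤ.* ℤ.+ 1 ℤ.+ ℤ.+ b ℤ.* ℤ.+ 1) / 1 ≡⟨ sym (cong₂ _+_ (ℕ→ℚ≡mkℚ a) (ℕ→ℚ≡mkℚ b)) ⟩
  ℕ→ℚ a + ℕ→ℚ b                            ∎

ℕ→ℚ-* : ∀ a b → ℕ→ℚ (a ℕ.* b) ≡ ℕ→ℚ a * ℕ→ℚ b
ℕ→ℚ-* a b = trans (cong (_/ 1) (ℤ.pos-* a b)) (sym (cong₂ _*_ (ℕ→ℚ≡mkℚ a) (ℕ→ℚ≡mkℚ b)))

ℕ→ℚ-suc-nonZero : ∀ k → NonZero (ℕ→ℚ (suc k))
ℕ→ℚ-suc-nonZero k = pos⇒nonZero (ℕ→ℚ (suc k)) {{normalize-pos (suc k) 1}}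

ℕ→ℚ-suc-*-cancelˡ : ∀ k {p q} → ℕ→ℚ (suc k) * p ≡ ℕ→ℚ (suc k) * q → p ≡ q
ℕ→ℚ-suc-*-cancelˡ k {p} {q} eq = begin
  p               ≡⟨ sym (*-identityˡ p) ⟩
  1ℚ * p          ≡⟨ cong (_* p) (sym (*-inverseˡ N)) ⟩
  1/ N * N * p    ≡⟨ *-assoc (1/ N) N p ⟩
  1/ N * (N * p)  ≡⟨ cong (1/ N *_) eq ⟩
  1/ N * (N * q)  ≡⟨ sym (*-assoc (1/ N) N q) ⟩
  1/ N * N * q    ≡⟨ cong (_* q) (*-inverseˡ N) ⟩
  1ℚ * q          ≡⟨ *-identityˡ q ⟩
  q               ∎
  where
  N = ℕ→ℚ (suc k)
  instance _ = ℕ→ℚ-suc-nonZero k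

-- In normal form the second factor is literally 1/ of the first.
ℕ→ℚ-suc-*-expm1/t : ∀ m → ℕ→ℚ (suc m) * expm1/t m ≡ 1ℚ
ℕ→ℚ-suc-*-expm1/t m =
  trans (cong₂ _*_ (ℕ→ℚ≡mkℚ (suc m)) (normalize-coprime (1-coprimeTo (suc m))))
        (*-inverseʳ (mkℚ (ℤ.+ suc m) 0 (coprime-sym (1-coprimeTo (suc m)))))

Sum : ℕ → (ℕ → ℚ) → ℚ
Sum n f = foldr _+_ 0ℚ (applyUpTo f n)

map-applyUpTo : ∀ (f : ℕ → ℚ) (g : ℕ → ℕ) n → map f (applyUpTo g n) ≡ applyUpTo (λ k → f (g k)) n
map-applyUpTo f g zero    = refl
map-applyUpTo f g (suc n) = cong (f (g 0) ∷_) (map-applyUpTo f (λ k → g (suc k)) n)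

Σ≤≡Sum : ∀ m f → Σ≤ m f ≡ Sum (suc m) f
Σ≤≡Sum m f = cong (foldr _+_ 0ℚ) (map-applyUpTo f (λ k → k) (suc m))

Sum-cong : ∀ n {f g} → (∀ k → k < n → f k ≡ g k) → Sum n f ≡ Sum n g
Sum-cong zero    eq = refl
Sum-cong (suc n) eq = cong₂ _+_ (eq 0 (s≤s z≤n)) (Sum-cong n (λ k k<n → eq (suc k) (s≤s k<n)))

Sum-+ : ∀ n f g → Sum n (λ k → f k + g k) ≡ Sum n f + Sum n g
Sum-+ zero    f g = refl
Sum-+ (suc n) f g = begin
  f 0 + g 0 + Sum n (λ k → f (suc k) + g (suc k))
    ≡⟨ cong (f 0 + g 0 +_) (Sum-+ n (λ k → f (suc k)) (λ k → g (suc k))) ⟩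
  f 0 + g 0 + (Sum n (λ k → f (suc k)) + Sum n (λ k → g (suc k)))
    ≡⟨ solve 4 (λ a b c d → a :+ b :+ (c :+ d) := a :+ c :+ (b :+ d)) refl (f 0) (g 0) _ _ ⟩
  f 0 + Sum n (λ k → f (suc k)) + (g 0 + Sum n (λ k → g (suc k)))
    ∎

Sum-zero : ∀ n f → (∀ k → f k ≡ 0ℚ) → Sum n f ≡ 0ℚ
Sum-zero zero    f eq = refl
Sum-zero (suc n) f eq = cong₂ _+_ (eq 0) (Sum-zero n (λ k → f (suc k)) (λ k → eq (suc k)))

Sum-snoc : ∀ n f → Sum (suc n) f ≡ Sum n f + f n
Sum-snoc zero    f = solve 1 (λ a → a :+ con 0ℚ := con 0ℚ :+ a) refl (f 0)
Sum-snoc (suc n) f = trans (cong (f 0 +_) (Sum-snoc n (λ k → f (suc k))))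
  (solve 3 (λ a b c → a :+ (b :+ c) := a :+ b :+ c) refl (f 0) _ _)

infix 4 _≐_
infixl 6 _⊕_

_≐_ : Moments → Moments → Set
a ≐ b = ∀ m → a m ≡ b m

_⊕_ : Moments → Moments → Moments
(a ⊕ b) m = a m + b m

𝟘 : Moments
𝟘 _ = 0ℚ

scalar : ℚ → Moments
scalar c zero    = c
scalar c (suc _) = 0ℚ

-- Derivative of the e.g.f.
D : Moments → Moments
D a m = a (suc m)

binomialTerm : Moments → Moments → ℕ → ℕ → ℚ
binomialTerm a b m k = ℕ→ℚ (m C k) * (a k * b (m ∸ k))

⊛-as-Sum : ∀ a b m → (a ⊛ b) m ≡ Sum (suc m) (binomialTerm a b m)
⊛-as-Sum a b m = Σ≤≡Sum m (binomialTerm a b m)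

⊛-at-0 : ∀ a b → (a ⊛ b) 0 ≡ a 0 * b 0
⊛-at-0 a b = solve 1 (λ x → con 1ℚ :* x :+ con 0ℚ := x) refl (a 0 * b 0)

⊛-cong : ∀ {a a′ b b′} → a ≐ a′ → b ≐ b′ → a ⊛ b ≐ a′ ⊛ b′
⊛-cong {a} {a′} {b} {b′} a≐a′ b≐b′ m = begin
  (a ⊛ b) m                               ≡⟨ ⊛-as-Sum a b m ⟩
  Sum (suc m) (binomialTerm a b m)         ≡⟨ Sum-cong (suc m) (λ k _ →
                                                cong₂ (λ x y → ℕ→ℚ (m C k) * (x * y)) (a≐a′ k) (b≐b′ (m ∸ k))) ⟩
  Sum (suc m) (binomialTerm a′ b′ m)       ≡⟨ sym (⊛-as-Sum a′ b′ m) ⟩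
  (a′ ⊛ b′) m                             ∎

⊛-distribʳ : ∀ a b c → (b ⊕ c) ⊛ a ≐ b ⊛ a ⊕ c ⊛ a
⊛-distribʳ a b c m = begin
  ((b ⊕ c) ⊛ a) m                                        ≡⟨ ⊛-as-Sum (b ⊕ c) a m ⟩
  Sum (suc m) (binomialTerm (b ⊕ c) a m)                  ≡⟨ Sum-cong (suc m) (λ k _ → distrib k) ⟩
  Sum (suc m) (λ k → binomialTerm b a m k + binomialTerm c a m k)
                                                          ≡⟨ Sum-+ (suc m) (binomialTerm b a m) (binomialTerm c a m) ⟩
  Sum (suc m) (binomialTerm b a m) + Sum (suc m) (binomialTerm c a m)
                                                          ≡⟨ sym (cong₂ _+_ (⊛-as-Sum b a m) (⊛-as-Sum c a m)) ⟩
  (b ⊛ a ⊕ c ⊛ a) m                                      ∎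
  where
  distrib : ∀ k → binomialTerm (b ⊕ c) a m k ≡ binomialTerm b a m k + binomialTerm c a m k
  distrib k = solve 4 (λ p x y z → p :* ((y :+ z) :* x) := p :* (y :* x) :+ p :* (z :* x))
                refl (ℕ→ℚ (m C k)) (a (m ∸ k)) (b k) (c k)

scalar-⊛ : ∀ c a m → (scalar c ⊛ a) m ≡ c * a m
scalar-⊛ c a m = begin
  (scalar c ⊛ a) m                                           ≡⟨ ⊛-as-Sum (scalar c) a m ⟩
  1ℚ * (c * a m) + Sum m (λ k → binomialTerm (scalar c) a m (suc k))
                                                             ≡⟨ cong (1ℚ * (c * a m) +_) (Sum-zero m _ higher-vanish) ⟩
  1ℚ * (c * a m) + 0ℚ                                       ≡⟨ solve 2 (λ c x → con 1ℚ :* (c :* x) :+ con 0ℚ := c :* x) refl c (a m) ⟩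
  c * a m                                                    ∎
  where
  higher-vanish : ∀ k → binomialTerm (scalar c) a m (suc k) ≡ 0ℚ
  higher-vanish k = solve 2 (λ p x → p :* (con 0ℚ :* x) := con 0ℚ) refl (ℕ→ℚ (m C suc k)) (a (m ∸ suc k))

⊛-leibniz : ∀ a b → D (a ⊛ b) ≐ D a ⊛ b ⊕ a ⊛ D b
⊛-leibniz a b m = begin
  (a ⊛ b) (suc m)                          ≡⟨ ⊛-as-Sum a b (suc m) ⟩
  f 0 + Sum (suc m) (λ j → f (suc j))      ≡⟨ cong (f 0 +_) (trans (Sum-cong (suc m) (λ j _ → pascal j)) (Sum-+ (suc m) X Y)) ⟩
  f 0 + (Sum (suc m) X + Sum (suc m) Y)    ≡⟨ solve 3 (λ a b c → a :+ (b :+ c) := b :+ (a :+ c)) refl (f 0) (Sum (suc m) X) (Sum (suc m) Y) ⟩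
  Sum (suc m) X + (f 0 + Sum (suc m) Y)    ≡⟨ cong₂ _+_ (sym (⊛-as-Sum (D a) b m)) (sym ⊛-D-right) ⟩
  (D a ⊛ b) m + (a ⊛ D b) m                ∎
  where
  f = binomialTerm a b (suc m)
  X = binomialTerm (D a) b m
  Y : ℕ → ℚ
  Y j = ℕ→ℚ (m C suc j) * (a (suc j) * b (m ∸ j))
  pascal : ∀ j → f (suc j) ≡ X j + Y j
  pascal j = begin
    ℕ→ℚ (suc m C suc j) * x                  ≡⟨ cong (λ n → ℕ→ℚ n * x) (sym (nCk+nC[k+1]≡[n+1]C[k+1] m j)) ⟩
    ℕ→ℚ (m C j ℕ.+ m C suc j) * x            ≡⟨ cong (_* x) (ℕ→ℚ-+ (m C j) (m C suc j)) ⟩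
    (ℕ→ℚ (m C j) + ℕ→ℚ (m C suc j)) * x      ≡⟨ solve 3 (λ p q r → (p :+ q) :* r := p :* r :+ q :* r) refl (ℕ→ℚ (m C j)) (ℕ→ℚ (m C suc j)) x ⟩
    X j + Y j                                ∎
    where x = a (suc j) * b (m ∸ j)
  g : ℕ → ℚ
  g k = ℕ→ℚ (m C k) * (a k * b (suc m ∸ k))
  ⊛-D-right : (a ⊛ D b) m ≡ Sum (suc (suc m)) g
  ⊛-D-right = begin
    (a ⊛ D b) m                     ≡⟨ ⊛-as-Sum a (D b) m ⟩
    Sum (suc m) (binomialTerm a (D b) m)
                                    ≡⟨ Sum-cong (suc m) (λ k k≤m → cong (λ i → ℕ→ℚ (m C k) * (a k * b i)) (sym (+-∸-assoc 1 (≤-pred k≤m)))) ⟩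
    Sum (suc m) g                   ≡⟨ sym (+-identityʳ _) ⟩
    Sum (suc m) g + 0ℚ              ≡⟨ cong (Sum (suc m) g +_) (sym last-vanishes) ⟩
    Sum (suc m) g + g (suc m)       ≡⟨ sym (Sum-snoc (suc m) g) ⟩
    Sum (suc (suc m)) g             ∎
    where
    last-vanishes : g (suc m) ≡ 0ℚ
    last-vanishes = trans (cong (λ n → ℕ→ℚ n * y) (k>n⇒nCk≡0 (n<1+n m))) (*-zeroˡ y)
      where y = a (suc m) * b (suc m ∸ suc m)

⊛-comm : ∀ a b → a ⊛ b ≐ b ⊛ a
⊛-comm a b zero = begin
  (a ⊛ b) 0   ≡⟨ ⊛-at-0 a b ⟩
  a 0 * b 0   ≡⟨ *-comm (a 0) (b 0) ⟩
  b 0 * a 0   ≡⟨ sym (⊛-at-0 b a) ⟩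
  (b ⊛ a) 0   ∎
⊛-comm a b (suc m) = begin
  (a ⊛ b) (suc m)             ≡⟨ ⊛-leibniz a b m ⟩
  (D a ⊛ b) m + (a ⊛ D b) m   ≡⟨ cong₂ _+_ (⊛-comm (D a) b m) (⊛-comm a (D b) m) ⟩
  (b ⊛ D a) m + (D b ⊛ a) m   ≡⟨ +-comm ((b ⊛ D a) m) ((D b ⊛ a) m) ⟩
  (D b ⊛ a) m + (b ⊛ D a) m   ≡⟨ sym (⊛-leibniz b a m) ⟩
  (b ⊛ a) (suc m)             ∎

⊛-distribˡ : ∀ a b c → a ⊛ (b ⊕ c) ≐ a ⊛ b ⊕ a ⊛ c
⊛-distribˡ a b c m = begin
  (a ⊛ (b ⊕ c)) m          ≡⟨ ⊛-comm a (b ⊕ c) m ⟩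
  ((b ⊕ c) ⊛ a) m          ≡⟨ ⊛-distribʳ a b c m ⟩
  (b ⊛ a) m + (c ⊛ a) m    ≡⟨ cong₂ _+_ (⊛-comm b a m) (⊛-comm c a m) ⟩
  (a ⊛ b) m + (a ⊛ c) m    ∎

δ≐scalar1 : δ ≐ scalar 1ℚ
δ≐scalar1 zero    = refl
δ≐scalar1 (suc _) = refl

𝟘≐scalar0 : 𝟘 ≐ scalar 0ℚ
𝟘≐scalar0 zero    = refl
𝟘≐scalar0 (suc _) = refl

⊛-identityˡ : ∀ a → δ ⊛ a ≐ a
⊛-identityˡ a m = trans (⊛-cong {b = a} δ≐scalar1 (λ _ → refl) m) (trans (scalar-⊛ 1ℚ a m) (*-identityˡ (a m)))

⊛-zeroˡ : ∀ a → 𝟘 ⊛ a ≐ 𝟘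
⊛-zeroˡ a m = trans (⊛-cong {b = a} 𝟘≐scalar0 (λ _ → refl) m) (trans (scalar-⊛ 0ℚ a m) (*-zeroˡ (a m)))

⊛-assoc : ∀ a b c → (a ⊛ b) ⊛ c ≐ a ⊛ (b ⊛ c)
⊛-assoc a b c zero = begin
  ((a ⊛ b) ⊛ c) 0       ≡⟨ ⊛-at-0 (a ⊛ b) c ⟩
  (a ⊛ b) 0 * c 0       ≡⟨ cong (_* c 0) (⊛-at-0 a b) ⟩
  a 0 * b 0 * c 0       ≡⟨ *-assoc (a 0) (b 0) (c 0) ⟩
  a 0 * (b 0 * c 0)     ≡⟨ cong (a 0 *_) (sym (⊛-at-0 b c)) ⟩
  a 0 * (b ⊛ c) 0       ≡⟨ sym (⊛-at-0 a (b ⊛ c)) ⟩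
  (a ⊛ (b ⊛ c)) 0       ∎
⊛-assoc a b c (suc m) = begin
  ((a ⊛ b) ⊛ c) (suc m)
    ≡⟨ ⊛-leibniz (a ⊛ b) c m ⟩
  (D (a ⊛ b) ⊛ c) m + ((a ⊛ b) ⊛ D c) m
    ≡⟨ cong (_+ ((a ⊛ b) ⊛ D c) m)
         (trans (⊛-cong {b = c} (⊛-leibniz a b) (λ _ → refl) m) (⊛-distribʳ c (D a ⊛ b) (a ⊛ D b) m)) ⟩
  ((D a ⊛ b) ⊛ c) m + ((a ⊛ D b) ⊛ c) m + ((a ⊛ b) ⊛ D c) m
    ≡⟨ cong₂ _+_ (cong₂ _+_ (⊛-assoc (D a) b c m) (⊛-assoc a (D b) c m)) (⊛-assoc a b (D c) m) ⟩
  (D a ⊛ (b ⊛ c)) m + (a ⊛ (D b ⊛ c)) m + (a ⊛ (b ⊛ D c)) m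
    ≡⟨ +-assoc ((D a ⊛ (b ⊛ c)) m) ((a ⊛ (D b ⊛ c)) m) ((a ⊛ (b ⊛ D c)) m) ⟩
  (D a ⊛ (b ⊛ c)) m + ((a ⊛ (D b ⊛ c)) m + (a ⊛ (b ⊛ D c)) m)
    ≡⟨ cong ((D a ⊛ (b ⊛ c)) m +_)
         (sym (trans (⊛-cong {a} (λ _ → refl) (⊛-leibniz b c) m) (⊛-distribˡ a (D b ⊛ c) (b ⊛ D c) m))) ⟩
  (D a ⊛ (b ⊛ c)) m + (a ⊛ D (b ⊛ c)) m
    ≡⟨ sym (⊛-leibniz a (b ⊛ c) m) ⟩
  (a ⊛ (b ⊛ c)) (suc m)
    ∎

egf-commutativeSemiring : CommutativeSemiring _ _
egf-commutativeSemiring = record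
  { Carrier               = Moments
  ; _≈_                   = _≐_
  ; _+_                   = _⊕_
  ; _*_                   = _⊛_
  ; 0#                    = 𝟘
  ; 1#                    = δ
  ; isCommutativeSemiring = isCommutativeSemiringˡ record
    { +-isCommutativeMonoid = Pointwise.isCommutativeMonoid ℕ +-0-isCommutativeMonoid
    ; *-isCommutativeMonoid = isCommutativeMonoidˡ record
      { isSemigroup = record
        { isMagma = record
          { isEquivalence = Pointwise.isEquivalence ℕ isEquivalence
          ; ∙-cong        = ⊛-cong
          }
        ; assoc = ⊛-assoc
        }
      ; identityˡ = ⊛-identityˡ
      ; comm      = ⊛-comm
      }
    ; distribʳ = ⊛-distribʳ
    ; zeroˡ    = ⊛-zeroˡ
    }
  }
  where open import Algebra.Structures.Biased _≐_

open CommutativeSemiringSolver egf-commutativeSemiring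
  using () renaming (solve to solve≐; _:=_ to _:≐_; _:+_ to _:⊕_; _:*_ to _:⊛_; con to con≐)

-- The moments of t.
τ : Moments
τ zero          = 0ℚ
τ (suc zero)    = 1ℚ
τ (suc (suc _)) = 0ℚ

Dτ≐δ : D τ ≐ δ
Dτ≐δ zero    = refl
Dτ≐δ (suc _) = refl

θ : Moments → Moments
θ a = τ ⊛ D a

τ⊛-at-0 : ∀ a → (τ ⊛ a) 0 ≡ 0ℚ
τ⊛-at-0 a = trans (⊛-at-0 τ a) (*-zeroˡ (a 0))

τ⊛-suc : ∀ a m → (τ ⊛ a) (suc m) ≡ a m + θ a m
τ⊛-suc a m = begin
  (τ ⊛ a) (suc m)            ≡⟨ ⊛-leibniz τ a m ⟩
  (D τ ⊛ a) m + θ a m        ≡⟨ cong (_+ θ a m) (trans (⊛-cong {b = a} Dτ≐δ (λ _ → refl) m) (⊛-identityˡ a m)) ⟩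
  a m + θ a m                ∎

x+m*x≡[1+m]*x : ∀ m x → x + ℕ→ℚ m * x ≡ ℕ→ℚ (suc m) * x
x+m*x≡[1+m]*x m x = trans (solve 2 (λ n x → x :+ n :* x := (con 1ℚ :+ n) :* x) refl (ℕ→ℚ m) x)
                          (cong (_* x) (sym (ℕ→ℚ-+ 1 m)))

θ-coefficient : ∀ a m → θ a m ≡ ℕ→ℚ m * a m
θ-coefficient a zero    = trans (τ⊛-at-0 (D a)) (sym (*-zeroˡ (a 0)))
θ-coefficient a (suc m) = begin
  θ a (suc m)                         ≡⟨ τ⊛-suc (D a) m ⟩
  a (suc m) + θ (D a) m               ≡⟨ cong (a (suc m) +_) (θ-coefficient (D a) m) ⟩
  a (suc m) + ℕ→ℚ m * a (suc m)       ≡⟨ x+m*x≡[1+m]*x m (a (suc m)) ⟩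
  ℕ→ℚ (suc m) * a (suc m)             ∎

τ⊛-coefficient : ∀ a m → (τ ⊛ a) (suc m) ≡ ℕ→ℚ (suc m) * a m
τ⊛-coefficient a m = begin
  (τ ⊛ a) (suc m)        ≡⟨ τ⊛-suc a m ⟩
  a m + θ a m            ≡⟨ cong (a m +_) (θ-coefficient a m) ⟩
  a m + ℕ→ℚ m * a m      ≡⟨ x+m*x≡[1+m]*x m (a m) ⟩
  ℕ→ℚ (suc m) * a m      ∎

θ-leibniz : ∀ a b → θ (a ⊛ b) ≐ θ a ⊛ b ⊕ a ⊛ θ b
θ-leibniz a b m = begin
  (τ ⊛ D (a ⊛ b)) m                   ≡⟨ ⊛-cong {τ} (λ _ → refl) (⊛-leibniz a b) m ⟩
  (τ ⊛ (D a ⊛ b ⊕ a ⊛ D b)) m         ≡⟨ solve≐ 5 (λ t da b a db → t :⊛ (da :⊛ b :⊕ a :⊛ db) :≐ t :⊛ da :⊛ b :⊕ a :⊛ (t :⊛ db))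
                                             (λ _ → refl) τ (D a) b a (D b) m ⟩
  (θ a ⊛ b ⊕ a ⊛ θ b) m               ∎

expm1 : Moments
expm1 = τ ⊛ expm1/t

expm1-suc : ∀ m → expm1 (suc m) ≡ 1ℚ
expm1-suc m = trans (τ⊛-coefficient expm1/t m) (ℕ→ℚ-suc-*-expm1/t m)

D-expm1 : D expm1 ≐ expm1 ⊕ δ
D-expm1 zero    = trans (expm1-suc 0) (cong (_+ 1ℚ) (sym (τ⊛-at-0 expm1/t)))
D-expm1 (suc m) = trans (expm1-suc (suc m)) (cong (_+ 0ℚ) (sym (expm1-suc m)))

module _ (β : Moments) (bernoulli : IsBernoulliUmbra β) where

  bernoulli-⊛-expm1 : β ⊛ expm1 ≐ τ
  bernoulli-⊛-expm1 m = begin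
    (β ⊛ (τ ⊛ expm1/t)) m      ≡⟨ solve≐ 3 (λ b t u → b :⊛ (t :⊛ u) :≐ t :⊛ (b :⊛ u)) (λ _ → refl) β τ expm1/t m ⟩
    (τ ⊛ (β ⊛ expm1/t)) m      ≡⟨ ⊛-cong {τ} (λ _ → refl) bernoulli m ⟩
    (τ ⊛ δ) m                  ≡⟨ solve≐ 1 (λ t → t :⊛ con≐ 1 :≐ t) (λ _ → refl) τ m ⟩
    τ m                        ∎

  -- Differentiating β (e^t − 1) = t.
  bernoulli-derivative : D β ⊛ expm1 ⊕ τ ⊕ β ≐ δ
  bernoulli-derivative m = begin
    (D β ⊛ expm1) m + τ m + β m
      ≡⟨ cong (λ x → (D β ⊛ expm1) m + x + β m) (sym (bernoulli-⊛-expm1 m)) ⟩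
    (D β ⊛ expm1 ⊕ β ⊛ expm1 ⊕ β) m
      ≡⟨ solve≐ 3 (λ db w b → db :⊛ w :⊕ b :⊛ w :⊕ b :≐ db :⊛ w :⊕ b :⊛ (w :⊕ con≐ 1)) (λ _ → refl) (D β) expm1 β m ⟩
    (D β ⊛ expm1) m + (β ⊛ (expm1 ⊕ δ)) m
      ≡⟨ cong ((D β ⊛ expm1) m +_) (sym (⊛-cong {β} (λ _ → refl) D-expm1 m)) ⟩
    (D β ⊛ expm1 ⊕ β ⊛ D expm1) m
      ≡⟨ sym (⊛-leibniz β expm1 m) ⟩
    (β ⊛ expm1) (suc m)
      ≡⟨ bernoulli-⊛-expm1 (suc m) ⟩
    τ (suc m)
      ≡⟨ Dτ≐δ m ⟩
    δ m
      ∎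

  bernoulli-riccati : θ β ⊕ τ ⊛ β ⊕ β ⊛ β ≐ β
  bernoulli-riccati m = begin
    (τ ⊛ D β ⊕ τ ⊛ β ⊕ β ⊛ β) m
      ≡⟨ cong (λ x → x + (τ ⊛ β) m + (β ⊛ β) m) (⊛-cong {b = D β} (λ k → sym (bernoulli-⊛-expm1 k)) (λ _ → refl) m) ⟩
    ((β ⊛ expm1) ⊛ D β ⊕ τ ⊛ β ⊕ β ⊛ β) m
      ≡⟨ solve≐ 4 (λ b w db t → b :⊛ w :⊛ db :⊕ t :⊛ b :⊕ b :⊛ b :≐ b :⊛ (db :⊛ w :⊕ t :⊕ b)) (λ _ → refl) β expm1 (D β) τ m ⟩
    (β ⊛ (D β ⊛ expm1 ⊕ τ ⊕ β)) m
      ≡⟨ ⊛-cong {β} (λ _ → refl) bernoulli-derivative m ⟩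
    (β ⊛ δ) m
      ≡⟨ solve≐ 1 (λ b → b :⊛ con≐ 1 :≐ b) (λ _ → refl) β m ⟩
    β m
      ∎

  bernoulli-moment-0 : β 0 ≡ 1ℚ
  bernoulli-moment-0 = trans (sym (*-identityʳ (β 0))) (trans (sym (⊛-at-0 β expm1/t)) (bernoulli 0))

scalar-suc : ∀ n → scalar (ℕ→ℚ (suc n)) ≐ δ ⊕ scalar (ℕ→ℚ n)
scalar-suc n zero    = ℕ→ℚ-+ 1 n
scalar-suc n (suc _) = refl

-- If t β′ = β − t β − β², then t (βⁿ)′ = n (βⁿ − t βⁿ − βⁿ⁺¹), written without subtraction.
θ-power : ∀ β → θ β ⊕ τ ⊛ β ⊕ β ⊛ β ≐ β → ∀ n →
          θ (n ·ᵘ β) ⊕ scalar (ℕ→ℚ n) ⊛ (τ ⊛ (n ·ᵘ β) ⊕ suc n ·ᵘ β) ≐ scalar (ℕ→ℚ n) ⊛ (n ·ᵘ β)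
θ-power β riccati zero m = begin
  (θ δ ⊕ scalar 0ℚ ⊛ x) m      ≡⟨ cong₂ _+_ (⊛-cong {τ} {b′ = 𝟘} (λ _ → refl) (λ _ → refl) m) (⊛-cong {b = x} (λ k → sym (𝟘≐scalar0 k)) (λ _ → refl) m) ⟩
  (τ ⊛ 𝟘 ⊕ 𝟘 ⊛ x) m            ≡⟨ solve≐ 2 (λ t x → t :⊛ con≐ 0 :⊕ con≐ 0 :⊛ x :≐ con≐ 0 :⊛ con≐ 1) (λ _ → refl) τ x m ⟩
  (𝟘 ⊛ δ) m                    ≡⟨ ⊛-cong {b = δ} 𝟘≐scalar0 (λ _ → refl) m ⟩
  (scalar 0ℚ ⊛ δ) m            ∎
  where x = τ ⊛ δ ⊕ β ⊛ δ
θ-power β riccati (suc n) m = begin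
  (θ (β ⊛ Q) ⊕ ν′ ⊛ (τ ⊛ (β ⊛ Q) ⊕ β ⊛ (β ⊛ Q))) m
    ≡⟨ cong₂ _+_ (θ-leibniz β Q m) (⊛-cong {b = τ ⊛ (β ⊛ Q) ⊕ β ⊛ (β ⊛ Q)} (scalar-suc n) (λ _ → refl) m) ⟩
  (θ β ⊛ Q ⊕ β ⊛ θ Q ⊕ (δ ⊕ ν) ⊛ (τ ⊛ (β ⊛ Q) ⊕ β ⊛ (β ⊛ Q))) m
    ≡⟨ solve≐ 6 (λ θb θq b q t v →
                  θb :⊛ q :⊕ b :⊛ θq :⊕ (con≐ 1 :⊕ v) :⊛ (t :⊛ (b :⊛ q) :⊕ b :⊛ (b :⊛ q))
              :≐ (θb :⊕ t :⊛ b :⊕ b :⊛ b) :⊛ q :⊕ b :⊛ (θq :⊕ v :⊛ (t :⊛ q :⊕ b :⊛ q)))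
         (λ _ → refl) (θ β) (θ Q) β Q τ ν m ⟩
  ((θ β ⊕ τ ⊛ β ⊕ β ⊛ β) ⊛ Q ⊕ β ⊛ (θ Q ⊕ ν ⊛ (τ ⊛ Q ⊕ β ⊛ Q))) m
    ≡⟨ cong₂ _+_ (⊛-cong {b = Q} riccati (λ _ → refl) m) (⊛-cong {β} (λ _ → refl) (θ-power β riccati n) m) ⟩
  (β ⊛ Q ⊕ β ⊛ (ν ⊛ Q)) m
    ≡⟨ solve≐ 3 (λ b q v → b :⊛ q :⊕ b :⊛ (v :⊛ q) :≐ (con≐ 1 :⊕ v) :⊛ (b :⊛ q)) (λ _ → refl) β Q ν m ⟩
  ((δ ⊕ ν) ⊛ (β ⊛ Q)) m
    ≡⟨ ⊛-cong {b = β ⊛ Q} (λ k → sym (scalar-suc n k)) (λ _ → refl) m ⟩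
  (ν′ ⊛ (β ⊛ Q)) m
    ∎
  where
  Q = n ·ᵘ β
  ν = scalar (ℕ→ℚ n)
  ν′ = scalar (ℕ→ℚ (suc n))

-- The coefficient of t^{k+1} in θ-power for n = k + 1.
power-recurrence : ∀ β → θ β ⊕ τ ⊛ β ⊕ β ⊛ β ≐ β → ∀ k →
                   (suc (suc k) ·ᵘ β) (suc k) ≡ - (ℕ→ℚ (suc k) * (suc k ·ᵘ β) k)
power-recurrence β riccati k = inverseʳ-unique (N * Y) Z (ℕ→ℚ-suc-*-cancelˡ k (trans NY+Z-vanishes (sym (*-zeroʳ N))))
  where
  N = ℕ→ℚ (suc k)
  Q = suc k ·ᵘ β
  X = Q (suc k)
  Y = Q k
  Z = (β ⊛ Q) (suc k)
  coefficient : N * X + N * (N * Y + Z) ≡ N * X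
  coefficient = begin
    N * X + N * (N * Y + Z)
      ≡⟨ sym (cong₂ _+_ (θ-coefficient Q (suc k))
                        (trans (scalar-⊛ N (τ ⊛ Q ⊕ β ⊛ Q) (suc k)) (cong (λ y → N * (y + Z)) (τ⊛-coefficient Q k)))) ⟩
    (θ Q ⊕ scalar N ⊛ (τ ⊛ Q ⊕ β ⊛ Q)) (suc k)
      ≡⟨ θ-power β riccati (suc k) (suc k) ⟩
    (scalar N ⊛ Q) (suc k)
      ≡⟨ scalar-⊛ N Q (suc k) ⟩
    N * X
      ∎
  NY+Z-vanishes : N * (N * Y + Z) ≡ 0ℚ
  NY+Z-vanishes = identityʳ-unique (N * X) (N * (N * Y + Z)) coefficient

s1-suc : ∀ k → s1 (suc k) ≡ - (ℕ→ℚ (suc k) * s1 k)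
s1-suc k = begin
  (- sign k) * ℕ→ℚ (suc k ℕ.* k !)            ≡⟨ cong ((- sign k) *_) (ℕ→ℚ-* (suc k) (k !)) ⟩
  (- sign k) * (ℕ→ℚ (suc k) * ℕ→ℚ (k !))      ≡⟨ solve 3 (λ s n f → (:- s) :* (n :* f) := :- (n :* (s :* f))) refl (sign k) (ℕ→ℚ (suc k)) (ℕ→ℚ (k !)) ⟩
  - (ℕ→ℚ (suc k) * s1 k)                      ∎

proposition7p1 : (ι : Moments) → IsBernoulliUmbra ι →
    (k : ℕ) → (suc k ·ᵘ ι) k ≡ s1 k
proposition7p1 ι bernoulli zero = begin
  (ι ⊛ δ) 0     ≡⟨ ⊛-at-0 ι δ ⟩
  ι 0 * 1ℚ      ≡⟨ *-identityʳ (ι 0) ⟩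
  ι 0           ≡⟨ bernoulli-moment-0 ι bernoulli ⟩
  1ℚ            ∎
proposition7p1 ι bernoulli (suc k) = begin
  (suc (suc k) ·ᵘ ι) (suc k)          ≡⟨ power-recurrence ι (bernoulli-riccati ι bernoulli) k ⟩
  - (ℕ→ℚ (suc k) * (suc k ·ᵘ ι) k)    ≡⟨ cong (λ x → - (ℕ→ℚ (suc k) * x)) (proposition7p1 ι bernoulli k) ⟩
  - (ℕ→ℚ (suc k) * s1 k)              ≡⟨ sym (s1-suc k) ⟩
  s1 (suc k)                          ∎
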